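{- Let $n>5$. In the $1:1$ PathWalker-Breaker game played on the complete graph $K_n$, under optimal play by both players (regardless of which player moves first), PathWalker visits exactly $n-2$ vertices, i.e. all but two vertices.
   Context: The $1:\beta$ PathWalker-Breaker game on a graph $G$: two players, (Path)Walker and Breaker, alternate turns. Walker is positioned at a vertex of $G$ (her initial vertex counts as visited). On her turn she moves from her current vertex $v$ along an edge $e=vw$ of $G$ that has not been acquired by Breaker and such that $w$ has not previously been visited by her; she thereby acquires $e$ and visits $w$. On his turn Breaker acquires $\beta$ edges of $G$ not already acquired by either player. The game ends when there is no path from Walker's current position to an unvisited vertex using only edges not acquired by Breaker and (apart from the current position) only previously unvisited vertices. Walker wants to maximize, and Breaker to minimize, the number of vertices Walker visits. Here $\beta=1$. -}

module Defs where

open import Data.Nat using (ℕ; _≤_; _≥_)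
open import Data.Fin using (Fin; _≟_)
open import Data.Fin.Subset using (Subset; _∈_; _∉_; _∪_; ⁅_⁆; ∣_∣)
open import Data.Bool using (Bool; true; false; _∧_; _∨_)
open import Data.Product using (_×_; ∃; Σ)
open import Data.Sum using (_⊎_)
open import Relation.Nullary using (¬_)
open import Relation.Nullary.Decidable using (⌊_⌋)
open import Relation.Binary.PropositionalEquality using (_≡_; _≢_)

-- The 1:1 PathWalker-Breaker game on the complete graph K_n,
-- vertex set Fin n, edges = unordered pairs {u,v} with u ≢ v.
-- Edge sets are encoded as Bool-valued relations kept symmetric.

EdgeSet : ℕ → Set
EdgeSet n = Fin n → Fin n → Bool

addEdge : ∀ {n} → EdgeSet n → Fin n → Fin n → EdgeSet n
addEdge f u v x y = f x y ∨ (⌊ x ≟ u ⌋ ∧ ⌊ y ≟ v ⌋) ∨ (⌊ x ≟ v ⌋ ∧ ⌊ y ≟ u ⌋)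

record State (n : ℕ) : Set where
  constructor mkState
  field
    pos     : Fin n
    visited : Subset n
    brk     : EdgeSet n
    wlk     : EdgeSet n
open State public

initState : ∀ {n} → Fin n → State n
initState v = mkState v ⁅ v ⁆ (λ _ _ → false) (λ _ _ → false)

WalkerMove : ∀ {n} → State n → Fin n → Set
WalkerMove s w = (pos s ≢ w) × (brk s (pos s) w ≡ false) × (w ∉ visited s)

walkerStep : ∀ {n} → State n → Fin n → State n
walkerStep s w = mkState w (visited s ∪ ⁅ w ⁆) (brk s) (addEdge (wlk s) (pos s) w)

BreakerMove : ∀ {n} → State n → Fin n → Fin n → Set
BreakerMove s u v = (u ≢ v) × (brk s u v ≡ false) × (wlk s u v ≡ false)

breakerStep : ∀ {n} → State n → Fin n → Fin n → State n
breakerStep s u v = mkState (pos s) (visited s) (addEdge (brk s) u v) (wlk s)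

data OpenWalk {n : ℕ} (s : State n) : Fin n → Set where
  here : OpenWalk s (pos s)
  step : ∀ {x y} → OpenWalk s x → x ≢ y → brk s x y ≡ false → y ∉ visited s
       → OpenWalk s y

GameOver : ∀ {n} → State n → Set
GameOver s = ¬ (∃ λ y → (y ∉ visited s) × OpenWalk s y)

nVisited : ∀ {n} → State n → ℕ
nVisited s = ∣ visited s ∣

-- Walker can guarantee visiting at least k vertices
-- (WalkerTurnW: Walker to move; BreakerTurnW: Breaker to move)
mutual
  data WalkerTurnW {n : ℕ} (k : ℕ) (s : State n) : Set where
    reached : k ≤ nVisited s → WalkerTurnW k s
    move    : (w : Fin n) → WalkerMove s w → BreakerTurnW k (walkerStep s w)
            → WalkerTurnW k s

  data BreakerTurnW {n : ℕ} (k : ℕ) (s : State n) : Set where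
    reached : k ≤ nVisited s → BreakerTurnW k s
    respond : ¬ GameOver s
            → ((u v : Fin n) → BreakerMove s u v → WalkerTurnW k (breakerStep s u v))
            → BreakerTurnW k s

-- Breaker can guarantee that Walker visits at most k vertices
mutual
  data WalkerTurnB {n : ℕ} (k : ℕ) (s : State n) : Set where
    hold : nVisited s ≤ k
         → ((w : Fin n) → WalkerMove s w → BreakerTurnB k (walkerStep s w))
         → WalkerTurnB k s

  data BreakerTurnB {n : ℕ} (k : ℕ) (s : State n) : Set where
    over : nVisited s ≤ k → GameOver s → BreakerTurnB k s
    move : nVisited s ≤ k → (u v : Fin n) → BreakerMove s u v
         → WalkerTurnB k (breakerStep s u v) → BreakerTurnB k s

-- the value of the game (under optimal play) is exactly k
WalkerFirstValue : ∀ {n} → Fin n → ℕ → Set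
WalkerFirstValue v k = WalkerTurnW k (initState v) × WalkerTurnB k (initState v)

BreakerFirstValue : ∀ {n} → Fin n → ℕ → Set
BreakerFirstValue v k = BreakerTurnW k (initState v) × BreakerTurnB k (initState v)

-- Call a vertex live if it is Walker's position or unvisited: only Breaker's edges between live
-- vertices can still matter. Let k be the number of unvisited vertices.
--
-- After each of her moves every live Breaker edge joins her
-- position to one vertex c. Breaker then adds an edge ab. If a and b are distinct unvisited
-- vertices she steps to a or b, one of which she can reach since only the edge to c can block
-- them; then ab is the only live edge and it ends at her. Otherwise ab cannot survive her move, and
-- she goes to an unvisited vertex other than c and the end of ab opposite her, which exists while
-- k ≥ 3.
--
-- Breaker keeps her to n − 2. When she is to move he has blocked an edge ab between two unvisited
-- vertices, and when exactly three remain she is also blocked from the third. If she enters a, he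
-- blocks a new such pair away from b, or, when only b and one vertex c are left, the edge from a to
-- c, which strands her. If she goes elsewhere, he blocks her edge to a vertex outside {a, b}.

module Submission where

open import Defs
open import Data.Nat using (ℕ; zero; suc; _+_; _∸_; _≤_; _<_; z≤n; s≤s; _≤?_)
open import Data.Nat.Properties
  using (≤-refl; ≤-pred; <⇒≤; ≰⇒>; ≤-antisym; ≤-<-trans; n≤1+n; 1+n≰n; m≤m+n; +-suc; +-identityʳ; +-monoˡ-≤; +-monoʳ-≤; +-monoʳ-<;
         +-cancelˡ-≤; ∸-monoˡ-≤; +-∸-assoc; m+n∸n≡m; module ≤-Reasoning)
open import Data.Fin using (Fin; zero; suc; _≟_)
open import Data.Fin.Subset using (Subset; _∈_; _∉_; _∪_; ⁅_⁆; ∣_∣; inside; outside)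
open import Data.Fin.Subset.Properties
  using (_∈?_; ∣p∣≤n; ∣⁅x⁆∣≡1; x∈⁅x⁆; x∈⁅y⁆⇒x≡y; p⊆p∪q; x∈p∪q⁺; x∈p∪q⁻; ∪-identityʳ; p⊂q⇒∣p∣<∣q∣; drop-there)
open import Data.Vec using (_∷_)
open import Data.List using (List; []; _∷_; length)
open import Data.List.Relation.Unary.All as All using (All; []; _∷_)
open import Data.List.Relation.Unary.Unique.Propositional using (Unique; []; _∷_)
open import Data.Bool using (Bool; T; true; false; _∧_; _∨_)
open import Data.Bool.Properties using (T-≡; T-∨; T-∧; ¬-not)
open import Data.Product as Product using (Σ; ∃; _×_; _,_; proj₁; proj₂)
open import Data.Sum as Sum using (_⊎_; inj₁; inj₂; [_,_])
open import Data.Empty using (⊥; ⊥-elim)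
open import Function using (_∘_; id)
open import Function.Bundles using (Equivalence; _⇔_)
open import Relation.Nullary using (¬_; yes; no; contradiction)
open import Relation.Nullary.Decidable using (⌊_⌋; _×-dec_; ¬?; toWitness; fromWitness)
open import Relation.Binary.PropositionalEquality using (_≡_; _≢_; refl; sym; trans; cong; subst; module ≡-Reasoning)

open Equivalence using (to; from)

private
  variable
    n k : ℕ
    p : Subset n
    a b c u v w x y z : Fin n
    s t : State n
    P Q : Fin n → Fin n → Set

-- Arithmetic and counting

m+k≡n⇒n∸2≤m : ∀ {m} → k ≤ 2 → m + k ≡ n → n ∸ 2 ≤ m
m+k≡n⇒n∸2≤m {k} {n} {m} k≤2 refl = begin
  m + k ∸ 2 ≤⟨ ∸-monoˡ-≤ 2 (+-monoʳ-≤ m k≤2) ⟩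
  m + 2 ∸ 2 ≡⟨ m+n∸n≡m m 2 ⟩
  m         ∎
  where open ≤-Reasoning

m+[2+k]≡n⇒m≤n∸2 : ∀ {m} → m + suc (suc k) ≡ n → m ≤ n ∸ 2
m+[2+k]≡n⇒m≤n∸2 {k} {m = m} refl = begin
  m                   ≤⟨ m≤m+n m k ⟩
  m + k               ≡⟨ +-∸-assoc m (s≤s (s≤s z≤n)) ⟨
  m + suc (suc k) ∸ 2 ∎
  where open ≤-Reasoning

∣p∣<n⇒∃∉ : (p : Subset n) → ∣ p ∣ < n → ∃ λ x → x ∉ p
∣p∣<n⇒∃∉ (outside ∷ p) _        = zero , λ ()
∣p∣<n⇒∃∉ (inside  ∷ p) (s≤s lt) = Product.map suc (_∘ drop-there) (∣p∣<n⇒∃∉ p lt)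

x∉p∪⁅y⁆⇒x∉p : x ∉ p ∪ ⁅ y ⁆ → x ∉ p
x∉p∪⁅y⁆⇒x∉p {y = y} x∉ = x∉ ∘ p⊆p∪q ⁅ y ⁆

x∉p∪⁅y⁆⇒x≢y : x ∉ p ∪ ⁅ y ⁆ → x ≢ y
x∉p∪⁅y⁆⇒x≢y x∉ refl = x∉ (x∈p∪q⁺ (inj₂ (x∈⁅x⁆ _)))

x∉p⇒x≢y⇒x∉p∪⁅y⁆ : x ∉ p → x ≢ y → x ∉ p ∪ ⁅ y ⁆
x∉p⇒x≢y⇒x∉p∪⁅y⁆ x∉p x≢y x∈ = [ x∉p , x≢y ∘ x∈⁅y⁆⇒x≡y _ ] (x∈p∪q⁻ _ _ x∈)

∈∉⇒≢ : x ∈ p → y ∉ p → x ≢ y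
∈∉⇒≢ x∈ y∉ refl = y∉ x∈

∣p∪⁅x⁆∣≤1+∣p∣ : (p : Subset n) (x : Fin n) → ∣ p ∪ ⁅ x ⁆ ∣ ≤ suc ∣ p ∣
∣p∪⁅x⁆∣≤1+∣p∣ (outside ∷ p) zero    rewrite ∪-identityʳ p = ≤-refl
∣p∪⁅x⁆∣≤1+∣p∣ (inside  ∷ p) zero    rewrite ∪-identityʳ p = n≤1+n _
∣p∪⁅x⁆∣≤1+∣p∣ (outside ∷ p) (suc x) = ∣p∪⁅x⁆∣≤1+∣p∣ p x
∣p∪⁅x⁆∣≤1+∣p∣ (inside  ∷ p) (suc x) = s≤s (∣p∪⁅x⁆∣≤1+∣p∣ p x)

x∉p⇒∣p∪⁅x⁆∣≡1+∣p∣ : x ∉ p → ∣ p ∪ ⁅ x ⁆ ∣ ≡ suc ∣ p ∣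
x∉p⇒∣p∪⁅x⁆∣≡1+∣p∣ {x = x} {p = p} x∉p = ≤-antisym (∣p∪⁅x⁆∣≤1+∣p∣ p x) ∣p∣<∣p∪⁅x⁆∣
  where
  ∣p∣<∣p∪⁅x⁆∣ : ∣ p ∣ < ∣ p ∪ ⁅ x ⁆ ∣
  ∣p∣<∣p∪⁅x⁆∣ = p⊂q⇒∣p∣<∣q∣ (p⊆p∪q ⁅ x ⁆ , x , x∈p∪q⁺ (inj₂ (x∈⁅x⁆ x)) , x∉p)

∃∉-avoiding : (p : Subset n) (xs : List (Fin n)) → ∣ p ∣ + length xs < n
             → ∃ λ x → x ∉ p × All (x ≢_) xs
∃∉-avoiding {n} p []       lt = Product.map₂ (_, []) (∣p∣<n⇒∃∉ p (subst (_< n) (+-identityʳ ∣ p ∣) lt))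
∃∉-avoiding {n} p (y ∷ ys) lt =
  Product.map₂ (λ (x∉ , x≢ys) → x∉p∪⁅y⁆⇒x∉p x∉ , x∉p∪⁅y⁆⇒x≢y x∉ ∷ x≢ys)
    (∃∉-avoiding (p ∪ ⁅ y ⁆) ys
      (≤-<-trans (+-monoˡ-≤ (length ys) (∣p∪⁅x⁆∣≤1+∣p∣ p y)) (subst (_< n) (+-suc ∣ p ∣ (length ys)) lt)))

∣p∣+∣xs∣≤n : (p : Subset n) (xs : List (Fin n)) → Unique xs → All (_∉ p) xs → ∣ p ∣ + length xs ≤ n
∣p∣+∣xs∣≤n p []       _            _            = subst (_≤ _) (sym (+-identityʳ _)) (∣p∣≤n p)
∣p∣+∣xs∣≤n p (x ∷ xs) (x≢xs ∷ xs!) (x∉p ∷ xs∉p) = begin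
  ∣ p ∣ + suc (length xs)   ≡⟨ +-suc ∣ p ∣ (length xs) ⟩
  suc ∣ p ∣ + length xs     ≡⟨ cong (_+ length xs) (x∉p⇒∣p∪⁅x⁆∣≡1+∣p∣ x∉p) ⟨
  ∣ p ∪ ⁅ x ⁆ ∣ + length xs ≤⟨ ∣p∣+∣xs∣≤n (p ∪ ⁅ x ⁆) xs xs! xs∉p∪⁅x⁆ ⟩
  _                         ∎
  where
  open ≤-Reasoning
  xs∉p∪⁅x⁆ : All (_∉ p ∪ ⁅ x ⁆) xs
  xs∉p∪⁅x⁆ = All.zipWith (λ (y∉p , x≢y) → x∉p⇒x≢y⇒x∉p∪⁅y⁆ y∉p (x≢y ∘ sym)) (xs∉p , x≢xs)

-- Edges

SameEdge : Fin n → Fin n → Fin n → Fin n → Set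
SameEdge x y u v = (x ≡ u × y ≡ v) ⊎ (x ≡ v × y ≡ u)

sameEdge-sym : SameEdge x y u v → SameEdge u v x y
sameEdge-sym = Sum.map (Product.map sym sym) (Product.map sym sym ∘ Product.swap)

sameEdge-cancelˡ : SameEdge x y x z → y ≢ x → y ≡ z
sameEdge-cancelˡ (inj₁ (_ , y≡z)) _   = y≡z
sameEdge-cancelˡ (inj₂ (_ , y≡x)) y≢x = ⊥-elim (y≢x y≡x)

otherEnd : Fin n → Fin n → Fin n → Fin n
otherEnd x u v with x ≟ u
... | yes _ = v
... | no  _ = u

sameEdge⇒otherEnd : SameEdge x y u v → y ≢ x → y ≡ otherEnd x u v
sameEdge⇒otherEnd {x = x} {u = u} e y≢x with x ≟ u | e
... | yes _   | inj₁ (_ , y≡v) = y≡v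
... | yes x≡u | inj₂ (_ , y≡u) = ⊥-elim (y≢x (trans y≡u (sym x≡u)))
... | no  x≢u | inj₁ (x≡u , _) = ⊥-elim (x≢u x≡u)
... | no  _   | inj₂ (_ , y≡u) = y≡u

unblocked≢blocked : ∀ (f : EdgeSet n) → f x y ≡ false → f x z ≡ true → y ≢ z
unblocked≢blocked f free blk refl with () ← trans (sym free) blk

module _ (f : EdgeSet n) {u v x y : Fin n} where

  private
    joins : Fin n → Fin n → Bool
    joins u′ v′ = ⌊ x ≟ u′ ⌋ ∧ ⌊ y ≟ v′ ⌋

    joins⁺ : ∀ {u′ v′} → x ≡ u′ × y ≡ v′ → T (joins u′ v′)
    joins⁺ {u′} {v′} = T-∧ {⌊ x ≟ u′ ⌋} {⌊ y ≟ v′ ⌋} .from ∘ Product.map fromWitness fromWitness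

    joins⁻ : ∀ {u′ v′} → T (joins u′ v′) → x ≡ u′ × y ≡ v′
    joins⁻ {u′} {v′} = Product.map toWitness toWitness ∘ T-∧ {⌊ x ≟ u′ ⌋} {⌊ y ≟ v′ ⌋} .to

    T-addEdge : T (addEdge f u v x y) ⇔ (T (f x y) ⊎ T (joins u v ∨ joins v u))
    T-addEdge = T-∨ {f x y}

    T-joins : T (joins u v ∨ joins v u) ⇔ (T (joins u v) ⊎ T (joins v u))
    T-joins = T-∨ {joins u v}

  addEdge⁺ : (f x y ≡ true) ⊎ SameEdge x y u v → addEdge f u v x y ≡ true
  addEdge⁺ = T-≡ .to ∘ T-addEdge .from ∘ Sum.map (T-≡ .from) (T-joins .from ∘ Sum.map joins⁺ joins⁺)

  addEdge⁻ : addEdge f u v x y ≡ true → (f x y ≡ true) ⊎ SameEdge x y u v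
  addEdge⁻ = Sum.map (T-≡ .to) (Sum.map joins⁻ joins⁻ ∘ T-joins .to) ∘ T-addEdge .to ∘ T-≡ .from

-- Invariants of a play

Live : State n → Fin n → Set
Live s x = x ≡ pos s ⊎ x ∉ visited s

UnvisitedPair : State n → Fin n → Fin n → Set
UnvisitedPair s x y = x ∉ visited s × y ∉ visited s × x ≢ y

sameEdge-unvisitedPair : ∀ (s : State n) → SameEdge x y u v → UnvisitedPair s x y → UnvisitedPair s u v
sameEdge-unvisitedPair _ (inj₁ (refl , refl)) pair              = pair
sameEdge-unvisitedPair _ (inj₂ (refl , refl)) (x∉ , y∉ , x≢y) = y∉ , x∉ , x≢y ∘ sym

-- The invariants are records, not type synonyms, so that Agda can infer the state from them.
record Remaining (s : State n) (k : ℕ) : Set where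
  constructor remaining
  field
    nVisited+k≡n : nVisited s + k ≡ n

remaining-init : (v : Fin (suc n)) → Remaining (initState v) n
remaining-init {n} v = remaining (cong (_+ n) (∣⁅x⁆∣≡1 v))

remaining-walkerStep : w ∉ visited s → Remaining s (suc k) → Remaining (walkerStep s w) k
remaining-walkerStep {w = w} {s = s} {k = k} w∉ (remaining eq) = remaining (begin
  ∣ visited s ∪ ⁅ w ⁆ ∣ + k ≡⟨ cong (_+ k) (x∉p⇒∣p∪⁅x⁆∣≡1+∣p∣ w∉) ⟩
  suc (nVisited s) + k      ≡⟨ +-suc (nVisited s) k ⟨
  nVisited s + suc k        ≡⟨ eq ⟩
  _                         ∎)
  where open ≡-Reasoning

remaining-breakerStep : Remaining s k → Remaining (breakerStep s u v) k
remaining-breakerStep (remaining eq) = remaining eq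

remaining⇒n∸2≤nVisited : ∀ {s : State n} → Remaining s k → k ≤ 2 → n ∸ 2 ≤ nVisited s
remaining⇒n∸2≤nVisited (remaining eq) k≤2 = m+k≡n⇒n∸2≤m k≤2 eq

remaining⇒nVisited≤n∸2 : ∀ {s : State n} → Remaining s (suc (suc k)) → nVisited s ≤ n ∸ 2
remaining⇒nVisited≤n∸2 (remaining eq) = m+[2+k]≡n⇒m≤n∸2 eq

unvisited-avoiding : Remaining s k → (xs : List (Fin n)) → length xs < k
                   → ∃ λ x → x ∉ visited s × All (x ≢_) xs
unvisited-avoiding {s = s} (remaining eq) xs lt =
  ∃∉-avoiding (visited s) xs (subst (nVisited s + length xs <_) eq (+-monoʳ-< (nVisited s) lt))

unvisited-atMost : Remaining s k → (xs : List (Fin n)) → Unique xs → All (_∉ visited s) xs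
                 → length xs ≤ k
unvisited-atMost {s = s} (remaining eq) xs xs! xs∉ =
  +-cancelˡ-≤ (nVisited s) _ _ (subst (nVisited s + length xs ≤_) (sym eq) (∣p∣+∣xs∣≤n (visited s) xs xs! xs∉))

unvisitedPair-avoiding : Remaining s k → 3 ≤ k → (b : Fin n)
                       → Σ (Fin n) λ x → Σ (Fin n) λ y → UnvisitedPair s x y × x ≢ b × y ≢ b
unvisitedPair-avoiding rem k≥3 b with unvisited-avoiding rem (b ∷ []) (<⇒≤ k≥3)
... | x , x∉ , x≢b ∷ [] with unvisited-avoiding rem (b ∷ x ∷ []) k≥3
...   | y , y∉ , y≢b ∷ y≢x ∷ [] = x , y , (x∉ , y∉ , y≢x ∘ sym) , x≢b , y≢b

record WellFormed (s : State n) : Set where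
  constructor wellFormed
  field
    pos∈visited    : pos s ∈ visited s
    wlk⇒∈visited : ∀ {x y} → wlk s x y ≡ true → y ∈ visited s
open WellFormed

wellFormed-init : (v : Fin n) → WellFormed (initState v)
wellFormed-init v = wellFormed (x∈⁅x⁆ v) λ ()

wellFormed-walkerStep : WellFormed s → WellFormed (walkerStep s w)
wellFormed-walkerStep {s = s} {w = w} (wellFormed p∈ wlk⊆) =
  wellFormed w∈ λ e → [ x∈p∪q⁺ ∘ inj₁ ∘ wlk⊆ , endpoint ] (addEdge⁻ (wlk s) e)
  where
  w∈ : w ∈ visited s ∪ ⁅ w ⁆
  w∈ = x∈p∪q⁺ (inj₂ (x∈⁅x⁆ w))
  endpoint : SameEdge x y (pos s) w → y ∈ visited s ∪ ⁅ w ⁆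
  endpoint (inj₁ (_ , refl)) = w∈
  endpoint (inj₂ (_ , refl)) = x∈p∪q⁺ (inj₁ p∈)

wellFormed-breakerStep : WellFormed s → WellFormed (breakerStep s u v)
wellFormed-breakerStep (wellFormed p∈ wlk⊆) = wellFormed p∈ wlk⊆

walkerMove : WellFormed s → w ∉ visited s → brk s (pos s) w ≡ false → WalkerMove s w
walkerMove wf w∉ free = ∈∉⇒≢ (wf .pos∈visited) w∉ , free , w∉

breakerMove : WellFormed s → x ≢ y → y ∉ visited s → brk s x y ≡ false → BreakerMove s x y
breakerMove wf x≢y y∉ free = x≢y , free , ¬-not (y∉ ∘ wf .wlk⇒∈visited)

walkerMove⇒¬GameOver : WalkerMove s w → ¬ GameOver s
walkerMove⇒¬GameOver {w = w} (p≢w , free , w∉) gameOver = gameOver (w , w∉ , step here p≢w free w∉)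

unvisited≢pos : WellFormed s → x ∉ visited s → x ≢ pos s
unvisited≢pos wf x∉ = ∈∉⇒≢ (wf .pos∈visited) x∉ ∘ sym

unvisitedPair-avoidsPos : WellFormed s → UnvisitedPair s x y → ¬ SameEdge x y (pos s) z
unvisitedPair-avoidsPos {s = s} wf pair e = proj₁ (sameEdge-unvisitedPair s e pair) (wf .pos∈visited)

record LiveBlocks⊆ (s : State n) (P : Fin n → Fin n → Set) : Set where
  constructor liveBlocks⊆
  field
    liveBlock⇒ : ∀ {x y} → x ≢ y → Live s x → Live s y → brk s x y ≡ true → P x y
open LiveBlocks⊆

noLiveBlocks : (∀ x y → brk s x y ≡ false) → LiveBlocks⊆ s P
noLiveBlocks unblocked = liveBlocks⊆ λ {x} {y} _ _ _ blk → contradiction (trans (sym blk) (unblocked x y)) λ ()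

liveBlocks-map : (∀ {x y} → P x y → Q x y) → LiveBlocks⊆ s P → LiveBlocks⊆ s Q
liveBlocks-map f bnd = liveBlocks⊆ λ x≢y lx ly blk → f (bnd .liveBlock⇒ x≢y lx ly blk)

unblocked : LiveBlocks⊆ s P → x ≢ y → Live s x → Live s y → ¬ P x y → brk s x y ≡ false
unblocked bnd x≢y lx ly ¬P = ¬-not (¬P ∘ bnd .liveBlock⇒ x≢y lx ly)

liveBlocks-breakerStep : LiveBlocks⊆ s P → LiveBlocks⊆ (breakerStep s u v) (λ x y → SameEdge x y u v ⊎ P x y)
liveBlocks-breakerStep {s = s} bnd =
  liveBlocks⊆ λ x≢y lx ly blk → Sum.swap (Sum.map₁ (bnd .liveBlock⇒ x≢y lx ly) (addEdge⁻ (brk s) blk))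

spoke-unblocked : WellFormed s → LiveBlocks⊆ s (λ x y → SameEdge x y (pos s) b)
                → y ∉ visited s → y ≢ b → brk s (pos s) y ≡ false
spoke-unblocked {s = s} {y = y} wf bnd y∉ y≢b =
  unblocked bnd (y≢p ∘ sym) (inj₁ refl) (inj₂ y∉) (y≢b ∘ λ e → sameEdge-cancelˡ e y≢p)
  where
  y≢p : y ≢ pos s
  y≢p = unvisited≢pos wf y∉

live-walkerStep : ∀ {s : State n} {w x} → w ∉ visited s → Live (walkerStep s w) x → x ∉ visited s
live-walkerStep w∉ (inj₁ refl) = w∉
live-walkerStep w∉ (inj₂ x∉)   = x∉p∪⁅y⁆⇒x∉p x∉

liveBlocks-walkerStep : WellFormed s → w ∉ visited s
  → LiveBlocks⊆ s (λ x y → P x y ⊎ SameEdge x y (pos s) c)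
  → LiveBlocks⊆ (walkerStep s w) (λ x y → UnvisitedPair s x y × P x y)
liveBlocks-walkerStep {s = s} {P = P} wf w∉ bnd =
  liveBlocks⊆ λ x≢y lx ly → unvisitedBlock⇒ (live-walkerStep {s = s} w∉ lx , live-walkerStep {s = s} w∉ ly , x≢y)
  where
  unvisitedBlock⇒ : ∀ {x y} → UnvisitedPair s x y → brk s x y ≡ true → UnvisitedPair s x y × P x y
  unvisitedBlock⇒ pair@(x∉ , y∉ , x≢y) blk =
    pair , [ id , ⊥-elim ∘ unvisitedPair-avoidsPos wf pair ] (bnd .liveBlock⇒ x≢y (inj₂ x∉) (inj₂ y∉) blk)

-- Walker's strategy

SafeStep : State n → Set
SafeStep {n} s = Σ (Fin n) λ w → Σ (Fin n) λ b → w ∉ visited s × brk s (pos s) w ≡ false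
               × LiveBlocks⊆ (walkerStep s w) (λ x y → SameEdge x y w b)

safeStep-pair : WellFormed s → UnvisitedPair s a b
              → LiveBlocks⊆ s (λ x y → SameEdge x y a b ⊎ SameEdge x y (pos s) c) → SafeStep s
safeStep-pair {s = s} {a = a} {b = b} {c = c} wf pair@(a∉ , b∉ , a≢b) bnd
  with brk s (pos s) a in pa | brk s (pos s) b in pb
... | false | _     = a , b , a∉ , pa , liveBlocks-map proj₂ (liveBlocks-walkerStep wf a∉ bnd)
... | true  | false = b , a , b∉ , pb , liveBlocks-map (Sum.swap ∘ proj₂) (liveBlocks-walkerStep wf b∉ bnd)
... | true  | true  = ⊥-elim (a≢b (trans (blocked⇒c a∉ pa) (sym (blocked⇒c b∉ pb))))
  where
  blocked⇒c : z ∉ visited s → brk s (pos s) z ≡ true → z ≡ c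
  blocked⇒c {z} z∉ blk =
    [ ⊥-elim ∘ unvisitedPair-avoidsPos wf pair ∘ sameEdge-sym , (λ e → sameEdge-cancelˡ e z≢p) ]
      (bnd .liveBlock⇒ (z≢p ∘ sym) (inj₁ refl) (inj₂ z∉) blk)
    where
    z≢p : z ≢ pos s
    z≢p = unvisited≢pos wf z∉

safeStep-avoiding : Remaining s k → 3 ≤ k → WellFormed s → ¬ UnvisitedPair s a b
                  → LiveBlocks⊆ s (λ x y → SameEdge x y a b ⊎ SameEdge x y (pos s) c) → SafeStep s
safeStep-avoiding {s = s} {a = a} {b = b} {c = c} rem k≥3 wf ¬pair bnd
  with unvisited-avoiding rem (c ∷ otherEnd (pos s) a b ∷ []) k≥3
... | w , w∉ , w≢c ∷ w≢d ∷ [] =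
  w , c , w∉ , free , liveBlocks-map (⊥-elim ∘ abDead) (liveBlocks-walkerStep wf w∉ bnd)
  where
  w≢p : w ≢ pos s
  w≢p = unvisited≢pos wf w∉
  free : brk s (pos s) w ≡ false
  free = unblocked bnd (w≢p ∘ sym) (inj₁ refl) (inj₂ w∉)
           [ w≢d ∘ (λ e → sameEdge⇒otherEnd e w≢p) , w≢c ∘ (λ e → sameEdge-cancelˡ e w≢p) ]
  abDead : UnvisitedPair s x y × SameEdge x y a b → ⊥
  abDead (pair , ab) = ¬pair (sameEdge-unvisitedPair s ab pair)

safeStep : Remaining s k → 3 ≤ k → WellFormed s
         → LiveBlocks⊆ s (λ x y → SameEdge x y a b ⊎ SameEdge x y (pos s) c) → SafeStep s
safeStep {s = s} {a = a} {b = b} rem k≥3 wf bnd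
  with ¬? (a ∈? visited s) ×-dec ¬? (b ∈? visited s) ×-dec ¬? (a ≟ b)
... | yes pair  = safeStep-pair wf pair bnd
... | no  ¬pair = safeStep-avoiding rem k≥3 wf ¬pair bnd

mutual
  walkerTurnW : ∀ {n} k (s : State n) (a b c : Fin n) → Remaining s k → WellFormed s
              → LiveBlocks⊆ s (λ x y → SameEdge x y a b ⊎ SameEdge x y (pos s) c)
              → WalkerTurnW (n ∸ 2) s
  walkerTurnW zero    s a b c rem _  _   = reached (remaining⇒n∸2≤nVisited rem z≤n)
  walkerTurnW (suc k) s a b c rem wf bnd with 2 ≤? k
  ... | no  k≱2 = reached (remaining⇒n∸2≤nVisited rem (≰⇒> k≱2))
  ... | yes k≥2 with safeStep rem (s≤s k≥2) wf bnd
  ...   | w , b′ , w∉ , free , bnd′ =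
    move w (walkerMove wf w∉ free)
      (breakerTurnW k (walkerStep s w) b′ (remaining-walkerStep w∉ rem) (wellFormed-walkerStep wf) bnd′)

  breakerTurnW : ∀ {n} k (t : State n) (b : Fin n) → Remaining t k → WellFormed t
               → LiveBlocks⊆ t (λ x y → SameEdge x y (pos t) b)
               → BreakerTurnW (n ∸ 2) t
  breakerTurnW k t b rem wf bnd with 2 ≤? k
  ... | no  k≱2 = reached (remaining⇒n∸2≤nVisited rem (<⇒≤ (≰⇒> k≱2)))
  ... | yes k≥2 with unvisited-avoiding rem (b ∷ []) k≥2
  ...   | y , y∉ , y≢b ∷ [] =
    respond (walkerMove⇒¬GameOver (walkerMove wf y∉ (spoke-unblocked wf bnd y∉ y≢b)))
      (λ u v _ → walkerTurnW k (breakerStep t u v) u v b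
                   (remaining-breakerStep rem) (wellFormed-breakerStep wf) (liveBlocks-breakerStep bnd))

-- Breaker's strategy

breakerTurnB-endgame : ∀ {n} (t : State n) b → Remaining t 2 → WellFormed t
       → LiveBlocks⊆ t (λ x y → SameEdge x y (pos t) b)
       → b ∉ visited t → brk t (pos t) b ≡ true
       → BreakerTurnB (n ∸ 2) t
breakerTurnB-endgame {n} t b rem wf bnd b∉ pb with unvisited-avoiding rem (b ∷ []) (s≤s (s≤s z≤n))
... | c , c∉ , c≢b ∷ [] =
  move (remaining⇒nVisited≤n∸2 rem) (pos t) c
    (breakerMove wf (unvisited≢pos wf c∉ ∘ sym) c∉ (spoke-unblocked wf bnd c∉ c≢b))
    (hold (remaining⇒nVisited≤n∸2 rem) stuck)
  where
  stuck : (w : Fin n) → WalkerMove (breakerStep t (pos t) c) w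
        → BreakerTurnB (n ∸ 2) (walkerStep (breakerStep t (pos t) c) w)
  stuck w (_ , freeW , w∉) = ⊥-elim (1+n≰n (unvisited-atMost rem (b ∷ c ∷ w ∷ []) distinct (b∉ ∷ c∉ ∷ w∉ ∷ [])))
    where
    w≢b : w ≢ b
    w≢b = unblocked≢blocked (addEdge (brk t) (pos t) c) freeW (addEdge⁺ (brk t) (inj₁ pb))
    w≢c : w ≢ c
    w≢c = unblocked≢blocked (addEdge (brk t) (pos t) c) freeW (addEdge⁺ (brk t) (inj₂ (inj₁ (refl , refl))))
    distinct : Unique (b ∷ c ∷ w ∷ [])
    distinct = ((c≢b ∘ sym) ∷ (w≢b ∘ sym) ∷ []) ∷ ((w≢c ∘ sym) ∷ []) ∷ [] ∷ []

mutual
  breakerTurnB-spoke : ∀ {n} k (t : State n) (b : Fin n) → Remaining t (suc (suc k)) → WellFormed t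
                     → LiveBlocks⊆ t (λ x y → SameEdge x y (pos t) b)
                     → (2 ≤ k) ⊎ (b ∉ visited t × brk t (pos t) b ≡ true)
                     → BreakerTurnB (n ∸ 2) t
  breakerTurnB-spoke zero    t b rem wf bnd (inj₁ ())
  breakerTurnB-spoke zero    t b rem wf bnd (inj₂ (b∉ , pb)) = breakerTurnB-endgame t b rem wf bnd b∉ pb
  breakerTurnB-spoke (suc k) t b rem wf bnd spokeOrRoom
    with unvisitedPair-avoiding rem (s≤s (s≤s (s≤s z≤n))) b
  ... | x , y , pair@(x∉ , y∉ , x≢y) , x≢b , y≢b =
    move (remaining⇒nVisited≤n∸2 rem) x y (breakerMove wf x≢y y∉ free)
      (walkerTurnB k (breakerStep t x y) x y b (remaining-breakerStep rem) (wellFormed-breakerStep wf) pair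
        (addEdge⁺ (brk t) (inj₂ (inj₁ (refl , refl)))) (addEdge⁺ (brk t) (inj₂ (inj₂ (refl , refl))))
        (liveBlocks-breakerStep bnd) spokeOrRoom′)
    where
    free : brk t x y ≡ false
    free = unblocked bnd x≢y (inj₂ x∉) (inj₂ y∉) (unvisitedPair-avoidsPos wf pair)
    spokeOrRoom′ : (1 ≤ k) ⊎ (b ∉ visited t × b ≢ x × b ≢ y × addEdge (brk t) x y (pos t) b ≡ true)
    spokeOrRoom′ = Sum.map ≤-pred (λ (b∉ , pb) → b∉ , x≢b ∘ sym , y≢b ∘ sym , addEdge⁺ (brk t) (inj₁ pb)) spokeOrRoom

  walkerTurnB : ∀ {n} j (s : State n) (a b c : Fin n) → Remaining s (suc (suc (suc j))) → WellFormed s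
              → UnvisitedPair s a b → brk s a b ≡ true → brk s b a ≡ true
              → LiveBlocks⊆ s (λ x y → SameEdge x y a b ⊎ SameEdge x y (pos s) c)
              → (1 ≤ j) ⊎ (c ∉ visited s × c ≢ a × c ≢ b × brk s (pos s) c ≡ true)
              → WalkerTurnB (n ∸ 2) s
  walkerTurnB {n} j s a b c rem wf pair@(a∉ , b∉ , a≢b) ab ba bnd spokeOrRoom =
    hold (remaining⇒nVisited≤n∸2 rem) reply
    where
    reply : (w : Fin n) → WalkerMove s w → BreakerTurnB (n ∸ 2) (walkerStep s w)
    reply w (_ , free , w∉) with w ≟ a | w ≟ b
    ... | yes refl | _ =
      breakerTurnB-spoke j (walkerStep s a) b (remaining-walkerStep w∉ rem) (wellFormed-walkerStep wf)
        (liveBlocks-map proj₂ (liveBlocks-walkerStep wf w∉ bnd))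
        (inj₂ (x∉p⇒x≢y⇒x∉p∪⁅y⁆ b∉ (a≢b ∘ sym) , ab))
    ... | no _ | yes refl =
      breakerTurnB-spoke j (walkerStep s b) a (remaining-walkerStep w∉ rem) (wellFormed-walkerStep wf)
        (liveBlocks-map (Sum.swap ∘ proj₂) (liveBlocks-walkerStep wf w∉ bnd))
        (inj₂ (x∉p⇒x≢y⇒x∉p∪⁅y⁆ a∉ a≢b , ba))
    ... | no w≢a | no w≢b =
      breakerTurnB-pair j (walkerStep s w) a b (remaining-walkerStep w∉ rem) room (wellFormed-walkerStep wf)
        (x∉p⇒x≢y⇒x∉p∪⁅y⁆ a∉ (w≢a ∘ sym) , x∉p⇒x≢y⇒x∉p∪⁅y⁆ b∉ (w≢b ∘ sym) , a≢b) ab ba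
        (liveBlocks-map proj₂ (liveBlocks-walkerStep wf w∉ bnd))
      where
      room : 1 ≤ j
      room = [ id , fourUnvisited ] spokeOrRoom
        where
        fourUnvisited : c ∉ visited s × c ≢ a × c ≢ b × brk s (pos s) c ≡ true → 1 ≤ j
        fourUnvisited (c∉ , c≢a , c≢b , pc) =
          +-cancelˡ-≤ 3 1 j (unvisited-atMost rem (a ∷ b ∷ c ∷ w ∷ []) distinct (a∉ ∷ b∉ ∷ c∉ ∷ w∉ ∷ []))
          where
          w≢c : w ≢ c
          w≢c = unblocked≢blocked (brk s) free pc
          distinct : Unique (a ∷ b ∷ c ∷ w ∷ [])
          distinct = (a≢b ∷ (c≢a ∘ sym) ∷ (w≢a ∘ sym) ∷ [])
                   ∷ ((c≢b ∘ sym) ∷ (w≢b ∘ sym) ∷ [])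
                   ∷ ((w≢c ∘ sym) ∷ [])
                   ∷ [] ∷ []

  breakerTurnB-pair : ∀ {n} k (t : State n) (a b : Fin n) → Remaining t (suc (suc k)) → 1 ≤ k → WellFormed t
                    → UnvisitedPair t a b → brk t a b ≡ true → brk t b a ≡ true
                    → LiveBlocks⊆ t (λ x y → SameEdge x y a b)
                    → BreakerTurnB (n ∸ 2) t
  breakerTurnB-pair zero    t a b rem () wf pair ab ba bnd
  breakerTurnB-pair (suc j) t a b rem _  wf pair ab ba bnd
    with unvisited-avoiding rem (a ∷ b ∷ []) (s≤s (s≤s (s≤s z≤n)))
  ... | e , e∉ , e≢a ∷ e≢b ∷ [] =
    move (remaining⇒nVisited≤n∸2 rem) (pos t) e (breakerMove wf (e≢p ∘ sym) e∉ free)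
      (walkerTurnB j (breakerStep t (pos t) e) a b e (remaining-breakerStep rem) (wellFormed-breakerStep wf)
        pair (addEdge⁺ (brk t) (inj₁ ab)) (addEdge⁺ (brk t) (inj₁ ba))
        (liveBlocks-map Sum.swap (liveBlocks-breakerStep bnd))
        (inj₂ (e∉ , e≢a , e≢b , addEdge⁺ (brk t) (inj₂ (inj₁ (refl , refl))))))
    where
    e≢p : e ≢ pos t
    e≢p = unvisited≢pos wf e∉
    free : brk t (pos t) e ≡ false
    free = unblocked bnd (e≢p ∘ sym) (inj₁ refl) (inj₂ e∉) (unvisitedPair-avoidsPos wf pair ∘ sameEdge-sym)

gameValue : ∀ m (v : Fin (6 + m)) → WalkerFirstValue v (4 + m) × BreakerFirstValue v (4 + m)
gameValue m v =
  ( walkerTurnW _ s₀ v v v rem₀ wf₀ (noLiveBlocks λ _ _ → refl)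
  , hold (remaining⇒nVisited≤n∸2 rem₀) λ w (_ , _ , w∉) →
      breakerTurnB-spoke _ (walkerStep s₀ w) w (remaining-walkerStep w∉ rem₀) (wellFormed-walkerStep wf₀)
        (noLiveBlocks λ _ _ → refl) (inj₁ (s≤s (s≤s z≤n))))
  , ( breakerTurnW _ s₀ v rem₀ wf₀ (noLiveBlocks λ _ _ → refl)
    , breakerTurnB-spoke _ s₀ v rem₀ wf₀ (noLiveBlocks λ _ _ → refl) (inj₁ (s≤s (s≤s z≤n))))
  where
  s₀ : State (6 + m)
  s₀ = initState v
  rem₀ : Remaining s₀ (5 + m)
  rem₀ = remaining-init v
  wf₀ : WellFormed s₀
  wf₀ = wellFormed-init v

theorem1 : (n : ℕ) → 5 < n → (v : Fin n)
         → WalkerFirstValue v (n ∸ 2) × BreakerFirstValue v (n ∸ 2)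
theorem1 _ (s≤s (s≤s (s≤s (s≤s (s≤s (s≤s {n = m} z≤n)))))) = gameValue m
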